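{- Define integers $a_{\mathcal{G}}(n)$, $n\ge0$, by $a_{\mathcal{G}}(0)=1$, $a_{\mathcal{G}}(1)=-1$, $a_{\mathcal{G}}(2)=-1$ and, for $n\ge 3$, $$a_{\mathcal{G}}(n)=-\frac12\left(\sum_{k=0}^{n-2}a_{\mathcal{G}}(k)\binom{n-1}{k}2^{n-1-k}+\sum_{k=0}^{n-1}a_{\mathcal{G}}(k)\binom{n}{k}2^{n-k}\right).$$ Write $\operatorname{sech}(x)=\sum_{n\ge0}s_n\frac{x^n}{n!}$. Then $s_{2n+1}=0$ and $s_{2n}=a_{\mathcal{G}}(2n)$ for all $n\ge 0$. -}

module Defs where

open import Data.Nat using (ℕ; zero; suc; _∸_; _^_)
open import Data.Nat.Combinatorics using (_C_)
open import Data.Integer using (+_)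
open import Data.Rational using (ℚ; _/_; _+_; _*_; -_; ½; 0ℚ; 1ℚ)
open import Data.Product using (_×_)
open import Relation.Binary.PropositionalEquality using (_≡_)

ι : ℕ → ℚ
ι n = (+ n) / 1

-- sumTo n f = Σ_{k=0}^{n} f k  (inclusive upper bound)
sumTo : ℕ → (ℕ → ℚ) → ℚ
sumTo zero    f = f zero
sumTo (suc n) f = sumTo n f + f (suc n)

-- a satisfies the defining recurrence of a_G:
-- a(0)=1, a(1)=-1, a(2)=-1, and for n ≥ 3 (n = m+3)
-- a(n) = -1/2 ( Σ_{k=0}^{n-2} a(k) C(n-1,k) 2^(n-1-k) + Σ_{k=0}^{n-1} a(k) C(n,k) 2^(n-k) ).
-- (These conditions determine the sequence a uniquely.)
IsAG : (ℕ → ℚ) → Set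
IsAG a =
  (a 0 ≡ 1ℚ) × (a 1 ≡ - 1ℚ) × (a 2 ≡ - 1ℚ) ×
  (∀ m → let n = suc (suc (suc m)) in
     a n ≡ - (½ * ( sumTo (n ∸ 2) (λ k → a k * ι ((n ∸ 1) C k) * ι (2 ^ (n ∸ 1 ∸ k)))
                  + sumTo (n ∸ 1) (λ k → a k * ι (n C k) * ι (2 ^ (n ∸ k))))))

-- Taylor coefficients of cosh x = Σ c_n x^n / n!: c_n = 1 for n even, 0 for n odd.
coshCoeff : ℕ → ℚ
coshCoeff zero          = 1ℚ
coshCoeff (suc zero)    = 0ℚ
coshCoeff (suc (suc n)) = coshCoeff n

δ₀ : ℕ → ℚ
δ₀ zero    = 1ℚ
δ₀ (suc _) = 0ℚ

-- s is the sequence of (exponential) Taylor coefficients of sech x = 1 / cosh x,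
-- i.e. (Σ s_n x^n/n!) · cosh x = 1 as (exponential) power series:
-- Σ_{k=0}^{n} C(n,k) s_k c_{n-k} = [n = 0] for all n.
IsSechCoeffs : (ℕ → ℚ) → Set
IsSechCoeffs s = ∀ n → sumTo n (λ k → ι (n C k) * s k * coshCoeff (n ∸ k)) ≡ δ₀ n

-- Read a sequence as the exponential generating function Σ fₙ xⁿ/n!.  Binomial
-- convolution is then the product of series; it obeys the Leibniz rule for the
-- derivative (the shift), and is therefore associative.  As cosh x · 2eˣ = 1 + e^{2x},
-- the series S = sech x satisfies S e^{2x} = 2eˣ − S; differentiating once shows that
-- aₙ = sₙ + sₙ₊₁ obeys the recurrence defining a_G, whose solution is unique.
-- Since cosh is even, so is sech, whence s₂ₙ = s₂ₙ + s₂ₙ₊₁ = a_G(2n).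
module Submission where

open import Defs
open import Data.Nat as ℕ using (ℕ; zero; suc; _*_; _∸_; _^_; _≤_; _<_; z≤n; s≤s)
import Data.Nat.Properties as ℕ
open import Data.Nat.Combinatorics using (_C_; nCn≡1; k>n⇒nCk≡0; nCk+nC[k+1]≡[n+1]C[k+1])
open import Data.Nat.Induction using (<-rec)
open import Data.Rational using (ℚ; _+_; -_; _-_; 0ℚ; 1ℚ; ½) renaming (_*_ to _·_)
open import Data.Rational.Properties
  using (+-comm; +-assoc; +-identityˡ; +-identityʳ; *-comm; *-identityˡ; *-identityʳ; *-zeroˡ; *-zeroʳ;
         *-distribˡ-+)
open import Data.Rational.Solver using (module +-*-Solver)
open import Data.Bool using (Bool; true; false; not; _xor_)
open import Data.Bool.Properties using (not-involutive; not-distribˡ-xor)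
open import Data.Product using (_×_; _,_)
open import Relation.Binary.PropositionalEquality
open +-*-Solver

module NatEmbedding where
  open import Data.Nat.Coprimality using (1-coprimeTo) renaming (sym to coprime-sym)
  open import Data.Integer as ℤ using (+_)
  import Data.Integer.Properties as ℤ
  open import Data.Rational using (mkℚ; toℚᵘ)
  open import Data.Rational.Properties using (toℚᵘ-injective; fromℚᵘ-toℚᵘ; toℚᵘ-homo-+; toℚᵘ-homo-*)
  open import Data.Rational.Unnormalised as ℚᵘ using (mkℚᵘ; *≡*)
  import Data.Rational.Unnormalised.Properties as ℚᵘ

  ι-toℚᵘ : ∀ n → toℚᵘ (ι n) ≡ mkℚᵘ (+ n) 0
  ι-toℚᵘ n = cong toℚᵘ (fromℚᵘ-toℚᵘ (mkℚ (+ n) 0 (coprime-sym (1-coprimeTo n))))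

  ι-homo-+ : ∀ m n → ι (m ℕ.+ n) ≡ ι m + ι n
  ι-homo-+ m n = toℚᵘ-injective (begin
    toℚᵘ (ι (m ℕ.+ n))             ≡⟨ ι-toℚᵘ (m ℕ.+ n) ⟩
    mkℚᵘ (+ (m ℕ.+ n)) 0           ≈⟨ *≡* (cong (ℤ._* + 1) integral) ⟩
    mkℚᵘ (+ m) 0 ℚᵘ.+ mkℚᵘ (+ n) 0 ≡⟨ sym (cong₂ ℚᵘ._+_ (ι-toℚᵘ m) (ι-toℚᵘ n)) ⟩
    toℚᵘ (ι m) ℚᵘ.+ toℚᵘ (ι n)     ≈⟨ ℚᵘ.≃-sym (toℚᵘ-homo-+ (ι m) (ι n)) ⟩
    toℚᵘ (ι m + ι n)               ∎)
    where
    open ℚᵘ.≃-Reasoning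
    integral : + (m ℕ.+ n) ≡ + m ℤ.* + 1 ℤ.+ + n ℤ.* + 1
    integral = trans (ℤ.pos-+ m n) (sym (cong₂ ℤ._+_ (ℤ.*-identityʳ (+ m)) (ℤ.*-identityʳ (+ n))))

  ι-homo-* : ∀ m n → ι (m ℕ.* n) ≡ ι m · ι n
  ι-homo-* m n = toℚᵘ-injective (begin
    toℚᵘ (ι (m ℕ.* n))             ≡⟨ ι-toℚᵘ (m ℕ.* n) ⟩
    mkℚᵘ (+ (m ℕ.* n)) 0           ≈⟨ *≡* (cong (ℤ._* + 1) (ℤ.pos-* m n)) ⟩
    mkℚᵘ (+ m) 0 ℚᵘ.* mkℚᵘ (+ n) 0 ≡⟨ sym (cong₂ ℚᵘ._*_ (ι-toℚᵘ m) (ι-toℚᵘ n)) ⟩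
    toℚᵘ (ι m) ℚᵘ.* toℚᵘ (ι n)     ≈⟨ ℚᵘ.≃-sym (toℚᵘ-homo-* (ι m) (ι n)) ⟩
    toℚᵘ (ι m · ι n)               ∎)
    where open ℚᵘ.≃-Reasoning

open NatEmbedding using (ι-homo-+; ι-homo-*)

Seq : Set
Seq = ℕ → ℚ

sumTo-cong : ∀ n {f g : Seq} → (∀ k → k ≤ n → f k ≡ g k) → sumTo n f ≡ sumTo n g
sumTo-cong zero    f≗g = f≗g 0 z≤n
sumTo-cong (suc n) f≗g =
  cong₂ _+_ (sumTo-cong n (λ k k≤n → f≗g k (ℕ.m≤n⇒m≤1+n k≤n))) (f≗g (suc n) ℕ.≤-refl)

sumTo-distrib-+ : ∀ n (f g : Seq) → sumTo n (λ k → f k + g k) ≡ sumTo n f + sumTo n g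
sumTo-distrib-+ zero    f g = refl
sumTo-distrib-+ (suc n) f g =
  trans (cong (_+ (f (suc n) + g (suc n))) (sumTo-distrib-+ n f g))
        (solve 4 (λ a b c d → (a :+ b) :+ (c :+ d) := (a :+ c) :+ (b :+ d)) refl
               (sumTo n f) (sumTo n g) (f (suc n)) (g (suc n)))

sumTo-distribˡ-· : ∀ n c (f : Seq) → sumTo n (λ k → c · f k) ≡ c · sumTo n f
sumTo-distribˡ-· zero    c f = refl
sumTo-distribˡ-· (suc n) c f =
  trans (cong (_+ c · f (suc n)) (sumTo-distribˡ-· n c f))
        (sym (*-distribˡ-+ c (sumTo n f) (f (suc n))))

sumTo-suc : ∀ n (f : Seq) → sumTo (suc n) f ≡ f 0 + sumTo n (λ k → f (suc k))
sumTo-suc zero    f = refl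
sumTo-suc (suc n) f =
  trans (cong (_+ f (suc (suc n))) (sumTo-suc n f))
        (+-assoc (f 0) (sumTo n (λ k → f (suc k))) (f (suc (suc n))))

sumTo-zero : ∀ n (f : Seq) → (∀ k → k ≤ n → f k ≡ 0ℚ) → sumTo n f ≡ 0ℚ
sumTo-zero zero    f f≡0 = f≡0 0 z≤n
sumTo-zero (suc n) f f≡0 =
  cong₂ _+_ (sumTo-zero n f (λ k k≤n → f≡0 k (ℕ.m≤n⇒m≤1+n k≤n))) (f≡0 (suc n) ℕ.≤-refl)

sumTo-last : ∀ n (f : Seq) → (∀ k → k < n → f k ≡ 0ℚ) → sumTo n f ≡ f n
sumTo-last zero    f _   = refl
sumTo-last (suc n) f f≡0 =
  trans (cong (_+ f (suc n)) (sumTo-zero n f (λ k k≤n → f≡0 k (s≤s k≤n))))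
        (+-identityˡ (f (suc n)))

sumTo-head : ∀ n (f : Seq) → (∀ k → f (suc k) ≡ 0ℚ) → sumTo n f ≡ f 0
sumTo-head zero    f _   = refl
sumTo-head (suc n) f f≡0 =
  trans (cong₂ _+_ (sumTo-head n f f≡0) (f≡0 n)) (+-identityʳ (f 0))

-- Binomial convolution: the coefficient sequence of the product of two
-- exponential generating functions.  Note IsSechCoeffs s says s ⋆ coshCoeff ≗ δ₀.
infixl 7 _⋆_
_⋆_ : Seq → Seq → Seq
(f ⋆ g) n = sumTo n (λ k → ι (n C k) · f k · g (n ∸ k))

∂ : Seq → Seq
∂ f n = f (suc n)

⋆-congˡ : ∀ {f f′} g n → (∀ k → f k ≡ f′ k) → (f ⋆ g) n ≡ (f′ ⋆ g) n
⋆-congˡ g n f≗f′ = sumTo-cong n (λ k _ → cong (λ x → ι (n C k) · x · g (n ∸ k)) (f≗f′ k))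

⋆-congʳ : ∀ f {g g′} n → (∀ k → g k ≡ g′ k) → (f ⋆ g) n ≡ (f ⋆ g′) n
⋆-congʳ f n g≗g′ = sumTo-cong n (λ k _ → cong (λ x → ι (n C k) · f k · x) (g≗g′ (n ∸ k)))

⋆-distribʳ-+ : ∀ f f′ g n → ((λ k → f k + f′ k) ⋆ g) n ≡ (f ⋆ g) n + (f′ ⋆ g) n
⋆-distribʳ-+ f f′ g n = trans
  (sumTo-cong n (λ k _ → solve 4 (λ c a b x → c :* (a :+ b) :* x := c :* a :* x :+ c :* b :* x)
                                refl (ι (n C k)) (f k) (f′ k) (g (n ∸ k))))
  (sumTo-distrib-+ n _ _)

⋆-distribˡ-+ : ∀ f g g′ n → (f ⋆ (λ k → g k + g′ k)) n ≡ (f ⋆ g) n + (f ⋆ g′) n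
⋆-distribˡ-+ f g g′ n = trans
  (sumTo-cong n (λ k _ → *-distribˡ-+ (ι (n C k) · f k) (g (n ∸ k)) (g′ (n ∸ k))))
  (sumTo-distrib-+ n _ _)

⋆-scaleʳ : ∀ f c g n → (f ⋆ (λ k → c · g k)) n ≡ c · (f ⋆ g) n
⋆-scaleʳ f c g n = trans
  (sumTo-cong n (λ k _ → solve 4 (λ c a x b → a :* x :* (c :* b) := c :* (a :* x :* b))
                                refl c (ι (n C k)) (f k) (g (n ∸ k))))
  (sumTo-distribˡ-· n c _)

δ₀-∸ : ∀ {k n} → k < n → δ₀ (n ∸ k) ≡ 0ℚ
δ₀-∸ {zero}  {suc n} _         = refl
δ₀-∸ {suc k} {suc n} (s≤s k<n) = δ₀-∸ k<n

⋆-diagonal : ∀ (f g : Seq) n → ι (n C n) · f n · g (n ∸ n) ≡ f n · g 0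
⋆-diagonal f g n rewrite nCn≡1 n | ℕ.n∸n≡0 n = cong (_· g 0) (*-identityˡ (f n))

⋆-last : ∀ f g n → (∀ k → k < n → ι (n C k) · f k · g (n ∸ k) ≡ 0ℚ) → (f ⋆ g) n ≡ f n · g 0
⋆-last f g n earlier≡0 = trans (sumTo-last n _ earlier≡0) (⋆-diagonal f g n)

⋆-identityʳ : ∀ f n → (f ⋆ δ₀) n ≡ f n
⋆-identityʳ f n =
  trans (⋆-last f δ₀ n (λ k k<n → trans (cong (_·_ (ι (n C k) · f k)) (δ₀-∸ k<n))
                                         (*-zeroʳ (ι (n C k) · f k))))
        (*-identityʳ (f n))

⋆-identityˡ : ∀ f n → (δ₀ ⋆ f) n ≡ f n
⋆-identityˡ f n =
  trans (sumTo-head n _ (λ k → trans (cong (_· f (n ∸ suc k)) (*-zeroʳ (ι (n C suc k))))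
                                     (*-zeroˡ (f (n ∸ suc k)))))
        (*-identityˡ (f n))

⋆-leibniz : ∀ f g n → (f ⋆ g) (suc n) ≡ (∂ f ⋆ g) n + (f ⋆ ∂ g) n
⋆-leibniz f g n = begin
  sumTo (suc n) term
    ≡⟨ sumTo-suc n term ⟩
  term 0 + sumTo n (λ k → term (suc k))
    ≡⟨ cong (term 0 +_) (trans (sumTo-cong n (λ k _ → pascal k)) (sumTo-distrib-+ n _ _)) ⟩
  term 0 + ((∂ f ⋆ g) n + sumTo n right)
    ≡⟨ solve 3 (λ a b c → a :+ (b :+ c) := b :+ (a :+ c)) refl (term 0) ((∂ f ⋆ g) n) (sumTo n right) ⟩
  (∂ f ⋆ g) n + (term 0 + sumTo n right)
    ≡⟨ cong ((∂ f ⋆ g) n +_) lower ⟩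
  (∂ f ⋆ g) n + (f ⋆ ∂ g) n ∎
  where
  open ≡-Reasoning
  term : Seq
  term k = ι (suc n C k) · f k · g (suc n ∸ k)
  right : Seq
  right k = ι (n C suc k) · f (suc k) · g (n ∸ k)
  pascal : ∀ k → term (suc k) ≡ ι (n C k) · f (suc k) · g (n ∸ k) + right k
  pascal k = begin
    ι (suc n C suc k) · f (suc k) · g (n ∸ k)
      ≡⟨ cong (λ c → ι c · f (suc k) · g (n ∸ k)) (sym (nCk+nC[k+1]≡[n+1]C[k+1] n k)) ⟩
    ι (n C k ℕ.+ n C suc k) · f (suc k) · g (n ∸ k)
      ≡⟨ cong (λ c → c · f (suc k) · g (n ∸ k)) (ι-homo-+ (n C k) (n C suc k)) ⟩
    (ι (n C k) + ι (n C suc k)) · f (suc k) · g (n ∸ k)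
      ≡⟨ solve 4 (λ a b x y → (a :+ b) :* x :* y := a :* x :* y :+ b :* x :* y)
                 refl (ι (n C k)) (ι (n C suc k)) (f (suc k)) (g (n ∸ k)) ⟩
    ι (n C k) · f (suc k) · g (n ∸ k) + right k ∎
  shifted : Seq
  shifted k = ι (n C k) · f k · g (suc n ∸ k)
  lower : term 0 + sumTo n right ≡ (f ⋆ ∂ g) n
  lower = begin
    term 0 + sumTo n right                ≡⟨ sym (sumTo-suc n shifted) ⟩
    sumTo n shifted + shifted (suc n)     ≡⟨ cong (_+_ (sumTo n shifted)) lastVanishes ⟩
    sumTo n shifted + 0ℚ                  ≡⟨ +-identityʳ _ ⟩
    sumTo n shifted                       ≡⟨ sumTo-cong n (λ k k≤n → cong (λ m → ι (n C k) · f k · g m)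
                                                                          (ℕ.+-∸-assoc 1 k≤n)) ⟩
    (f ⋆ ∂ g) n                           ∎
    where
    lastVanishes : shifted (suc n) ≡ 0ℚ
    lastVanishes = trans (cong (λ c → ι c · f (suc n) · g (n ∸ n)) (k>n⇒nCk≡0 (ℕ.n<1+n n)))
                         (trans (cong (_· g (n ∸ n)) (*-zeroˡ (f (suc n)))) (*-zeroˡ (g (n ∸ n))))

⋆-assoc : ∀ f g h n → ((f ⋆ g) ⋆ h) n ≡ (f ⋆ (g ⋆ h)) n
⋆-assoc f g h zero =
  solve 3 (λ a b c → con 1ℚ :* (con 1ℚ :* a :* b) :* c := con 1ℚ :* a :* (con 1ℚ :* b :* c))
        refl (f 0) (g 0) (h 0)
⋆-assoc f g h (suc n) = begin
  ((f ⋆ g) ⋆ h) (suc n)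
    ≡⟨ ⋆-leibniz (f ⋆ g) h n ⟩
  (∂ (f ⋆ g) ⋆ h) n + ((f ⋆ g) ⋆ ∂ h) n
    ≡⟨ cong (_+ ((f ⋆ g) ⋆ ∂ h) n) (trans (⋆-congˡ h n (⋆-leibniz f g))
                                          (⋆-distribʳ-+ (∂ f ⋆ g) (f ⋆ ∂ g) h n)) ⟩
  ((∂ f ⋆ g) ⋆ h) n + ((f ⋆ ∂ g) ⋆ h) n + ((f ⋆ g) ⋆ ∂ h) n
    ≡⟨ cong₂ _+_ (cong₂ _+_ (⋆-assoc (∂ f) g h n) (⋆-assoc f (∂ g) h n)) (⋆-assoc f g (∂ h) n) ⟩
  (∂ f ⋆ (g ⋆ h)) n + (f ⋆ (∂ g ⋆ h)) n + (f ⋆ (g ⋆ ∂ h)) n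
    ≡⟨ +-assoc ((∂ f ⋆ (g ⋆ h)) n) ((f ⋆ (∂ g ⋆ h)) n) ((f ⋆ (g ⋆ ∂ h)) n) ⟩
  (∂ f ⋆ (g ⋆ h)) n + ((f ⋆ (∂ g ⋆ h)) n + (f ⋆ (g ⋆ ∂ h)) n)
    ≡⟨ cong (_+_ ((∂ f ⋆ (g ⋆ h)) n)) (sym (trans (⋆-congʳ f n (⋆-leibniz g h))
                                                   (⋆-distribˡ-+ f (∂ g ⋆ h) (g ⋆ ∂ h) n))) ⟩
  (∂ f ⋆ (g ⋆ h)) n + (f ⋆ ∂ (g ⋆ h)) n
    ≡⟨ sym (⋆-leibniz f (g ⋆ h) n) ⟩
  (f ⋆ (g ⋆ h)) (suc n) ∎
  where open ≡-Reasoning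

exp2 : Seq
exp2 n = ι (2 ^ n)

twoExp : Seq
twoExp _ = ι 2

-- cosh x · 2eˣ = 1 + e^{2x}, proved together with sinh x · 2eˣ = e^{2x} − 1.
mutual
  cosh⋆twoExp : ∀ n → (coshCoeff ⋆ twoExp) n ≡ δ₀ n + exp2 n
  cosh⋆twoExp zero    = refl
  cosh⋆twoExp (suc n) = begin
    (coshCoeff ⋆ twoExp) (suc n)                              ≡⟨ ⋆-leibniz coshCoeff twoExp n ⟩
    (∂ coshCoeff ⋆ twoExp) n + (coshCoeff ⋆ twoExp) n         ≡⟨ sinh⋆twoExp+cosh⋆twoExp n ⟩
    exp2 (suc n)                                              ≡⟨ sym (+-identityˡ _) ⟩
    0ℚ + exp2 (suc n)                                         ∎
    where open ≡-Reasoning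

  sinh⋆twoExp : ∀ n → (∂ coshCoeff ⋆ twoExp) n ≡ exp2 n - δ₀ n
  sinh⋆twoExp zero    = refl
  sinh⋆twoExp (suc n) = begin
    (∂ coshCoeff ⋆ twoExp) (suc n)                            ≡⟨ ⋆-leibniz (∂ coshCoeff) twoExp n ⟩
    (coshCoeff ⋆ twoExp) n + (∂ coshCoeff ⋆ twoExp) n         ≡⟨ +-comm ((coshCoeff ⋆ twoExp) n) _ ⟩
    (∂ coshCoeff ⋆ twoExp) n + (coshCoeff ⋆ twoExp) n         ≡⟨ sinh⋆twoExp+cosh⋆twoExp n ⟩
    exp2 (suc n)                                              ≡⟨ sym (+-identityʳ _) ⟩
    exp2 (suc n) - 0ℚ                                         ∎
    where open ≡-Reasoning

  sinh⋆twoExp+cosh⋆twoExp : ∀ n → (∂ coshCoeff ⋆ twoExp) n + (coshCoeff ⋆ twoExp) n ≡ exp2 (suc n)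
  sinh⋆twoExp+cosh⋆twoExp n = begin
    (∂ coshCoeff ⋆ twoExp) n + (coshCoeff ⋆ twoExp) n
      ≡⟨ cong₂ _+_ (sinh⋆twoExp n) (cosh⋆twoExp n) ⟩
    (exp2 n - δ₀ n) + (δ₀ n + exp2 n)
      ≡⟨ solve 2 (λ d e → (e :- d) :+ (d :+ e) := (con 1ℚ :+ con 1ℚ) :* e) refl (δ₀ n) (exp2 n) ⟩
    ι 2 · exp2 n
      ≡⟨ sym (ι-homo-* 2 (2 ^ n)) ⟩
    exp2 (suc n) ∎
    where open ≡-Reasoning

∂⋆exp2 : ∀ f n → (∂ f ⋆ exp2) n ≡ (f ⋆ exp2) (suc n) - ι 2 · (f ⋆ exp2) n
∂⋆exp2 f n = begin
  (∂ f ⋆ exp2) n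
    ≡⟨ solve 2 (λ y z → y := (y :+ z) :- z) refl ((∂ f ⋆ exp2) n) (ι 2 · (f ⋆ exp2) n) ⟩
  ((∂ f ⋆ exp2) n + ι 2 · (f ⋆ exp2) n) - ι 2 · (f ⋆ exp2) n
    ≡⟨ cong (λ x → ((∂ f ⋆ exp2) n + x) - ι 2 · (f ⋆ exp2) n) (sym f⋆∂exp2) ⟩
  ((∂ f ⋆ exp2) n + (f ⋆ ∂ exp2) n) - ι 2 · (f ⋆ exp2) n
    ≡⟨ cong (_- ι 2 · (f ⋆ exp2) n) (sym (⋆-leibniz f exp2 n)) ⟩
  (f ⋆ exp2) (suc n) - ι 2 · (f ⋆ exp2) n ∎
  where
  open ≡-Reasoning
  f⋆∂exp2 : (f ⋆ ∂ exp2) n ≡ ι 2 · (f ⋆ exp2) n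
  f⋆∂exp2 = trans (⋆-congʳ f n (λ k → ι-homo-* 2 (2 ^ k))) (⋆-scaleʳ f (ι 2) exp2 n)

⋆exp2-init : ∀ f p → sumTo p (λ k → f k · ι (suc p C k) · ι (2 ^ (suc p ∸ k)))
                   ≡ (f ⋆ exp2) (suc p) - f (suc p)
⋆exp2-init f p = begin
  sumTo p (λ k → f k · ι (suc p C k) · exp2 (suc p ∸ k))
    ≡⟨ sumTo-cong p (λ k _ → cong (_· exp2 (suc p ∸ k)) (*-comm (f k) (ι (suc p C k)))) ⟩
  sumTo p term
    ≡⟨ solve 2 (λ x y → x := (x :+ y) :- y) refl (sumTo p term) (f (suc p)) ⟩
  (sumTo p term + f (suc p)) - f (suc p)
    ≡⟨ cong (λ x → (sumTo p term + x) - f (suc p)) (sym lastTerm) ⟩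
  (f ⋆ exp2) (suc p) - f (suc p) ∎
  where
  open ≡-Reasoning
  term : Seq
  term k = ι (suc p C k) · f k · exp2 (suc p ∸ k)
  lastTerm : term (suc p) ≡ f (suc p)
  lastTerm = trans (⋆-diagonal f exp2 (suc p)) (*-identityʳ (f (suc p)))

odd : ℕ → Bool
odd zero    = false
odd (suc n) = not (odd n)

odd-∸ : ∀ n k → k ≤ n → odd n ≡ odd k xor odd (n ∸ k)
odd-∸ n       zero    _         = refl
odd-∸ (suc n) (suc k) (s≤s k≤n) = trans (cong not (odd-∸ n k k≤n)) (not-distribˡ-xor (odd k) (odd (n ∸ k)))

odd-double : ∀ n → odd (2 * n) ≡ false
odd-double zero    = refl
odd-double (suc n) = trans (cong odd (ℕ.*-suc 2 n)) (trans (not-involutive (odd (2 * n))) (odd-double n))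

coshCoeff-odd : ∀ n → odd n ≡ true → coshCoeff n ≡ 0ℚ
coshCoeff-odd zero          ()
coshCoeff-odd (suc zero)    _    = refl
coshCoeff-odd (suc (suc n)) oddn = coshCoeff-odd n (trans (sym (not-involutive (odd n))) oddn)

module Sech {s : Seq} (sech : IsSechCoeffs s) where

  sech-odd : ∀ n → odd n ≡ true → s n ≡ 0ℚ
  sech-odd = <-rec (λ n → odd n ≡ true → s n ≡ 0ℚ) step
    where
    step : ∀ n → (∀ {k} → k < n → odd k ≡ true → s k ≡ 0ℚ) → odd n ≡ true → s n ≡ 0ℚ
    step zero    _  ()
    step (suc n) ih oddN = begin
      s (suc n)                          ≡⟨ sym (*-identityʳ (s (suc n))) ⟩
      s (suc n) · coshCoeff 0            ≡⟨ sym (⋆-last s coshCoeff (suc n) earlier≡0) ⟩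
      (s ⋆ coshCoeff) (suc n)            ≡⟨ sech (suc n) ⟩
      0ℚ                                 ∎
      where
      open ≡-Reasoning
      -- The factor s k vanishes for odd k, and coshCoeff (suc n ∸ k) for even k.
      earlier≡0 : ∀ k → k < suc n → ι (suc n C k) · s k · coshCoeff (suc n ∸ k) ≡ 0ℚ
      earlier≡0 k k<N with odd k in oddk
      ... | true  = trans (cong (λ x → ι (suc n C k) · x · coshCoeff (suc n ∸ k)) (ih k<N oddk))
                          (trans (cong (_· coshCoeff (suc n ∸ k)) (*-zeroʳ (ι (suc n C k))))
                                 (*-zeroˡ (coshCoeff (suc n ∸ k))))
      ... | false = trans (cong (_·_ (ι (suc n C k) · s k)) (coshCoeff-odd (suc n ∸ k) odd[N∸k]))
                          (*-zeroʳ (ι (suc n C k) · s k))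
        where
        odd[N∸k] : odd (suc n ∸ k) ≡ true
        odd[N∸k] = trans (sym (trans (odd-∸ (suc n) k (ℕ.<⇒≤ k<N)) (cong (_xor odd (suc n ∸ k)) oddk))) oddN

  -- sech x · (1 + e^{2x}) = sech x · cosh x · 2eˣ = 2eˣ.
  sech⋆exp2 : ∀ n → (s ⋆ exp2) n ≡ ι 2 - s n
  sech⋆exp2 n = begin
    (s ⋆ exp2) n                                  ≡⟨ solve 2 (λ x y → y := (x :+ y) :- x) refl (s n) _ ⟩
    (s n + (s ⋆ exp2) n) - s n                    ≡⟨ cong (_- s n) s⋆[1+exp2] ⟩
    ι 2 - s n                                     ∎
    where
    open ≡-Reasoning
    s⋆[1+exp2] : s n + (s ⋆ exp2) n ≡ ι 2
    s⋆[1+exp2] = begin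
      s n + (s ⋆ exp2) n                          ≡⟨ cong (_+ (s ⋆ exp2) n) (sym (⋆-identityʳ s n)) ⟩
      (s ⋆ δ₀) n + (s ⋆ exp2) n                   ≡⟨ sym (⋆-distribˡ-+ s δ₀ exp2 n) ⟩
      (s ⋆ (λ k → δ₀ k + exp2 k)) n               ≡⟨ ⋆-congʳ s n (λ k → sym (cosh⋆twoExp k)) ⟩
      (s ⋆ (coshCoeff ⋆ twoExp)) n                ≡⟨ sym (⋆-assoc s coshCoeff twoExp n) ⟩
      ((s ⋆ coshCoeff) ⋆ twoExp) n                ≡⟨ ⋆-congˡ twoExp n sech ⟩
      (δ₀ ⋆ twoExp) n                             ≡⟨ ⋆-identityˡ twoExp n ⟩
      ι 2                                         ∎

  s₀ : s 0 ≡ 1ℚ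
  s₀ = trans (sym (*-identityʳ (s 0))) (trans (sym (⋆-diagonal s coshCoeff 0)) (sech 0))

  s₀+s₂ : s 0 + s 2 ≡ 0ℚ
  s₀+s₂ = trans (solve 4 (λ a b c d → a :+ c := con 1ℚ :* a :* con 1ℚ :+ d :* b :* con 0ℚ :+ con 1ℚ :* c :* con 1ℚ)
                         refl (s 0) (s 1) (s 2) (ι 2))
                (sech 2)

  s₂ : s 2 ≡ - 1ℚ
  s₂ = begin
    s 2                ≡⟨ solve 2 (λ a c → c := (a :+ c) :- a) refl (s 0) (s 2) ⟩
    (s 0 + s 2) - s 0  ≡⟨ cong₂ _-_ s₀+s₂ s₀ ⟩
    0ℚ - 1ℚ            ≡⟨⟩
    - 1ℚ               ∎
    where open ≡-Reasoning

  pairSum : Seq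
  pairSum k = s k + s (suc k)

  pairSum⋆exp2 : ∀ m → (pairSum ⋆ exp2) m ≡ s m - s (suc m)
  pairSum⋆exp2 m = begin
    (pairSum ⋆ exp2) m
      ≡⟨ ⋆-distribʳ-+ s (∂ s) exp2 m ⟩
    (s ⋆ exp2) m + (∂ s ⋆ exp2) m
      ≡⟨ cong (_+_ ((s ⋆ exp2) m)) (∂⋆exp2 s m) ⟩
    (s ⋆ exp2) m + ((s ⋆ exp2) (suc m) - ι 2 · (s ⋆ exp2) m)
      ≡⟨ cong₂ (λ u v → u + (v - ι 2 · u)) (sech⋆exp2 m) (sech⋆exp2 (suc m)) ⟩
    (ι 2 - s m) + ((ι 2 - s (suc m)) - ι 2 · (ι 2 - s m))
      ≡⟨ solve 2 (λ a b → (con (ι 2) :- a) :+ ((con (ι 2) :- b) :- con (ι 2) :* (con (ι 2) :- a)) := a :- b)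
                 refl (s m) (s (suc m)) ⟩
    s m - s (suc m) ∎
    where open ≡-Reasoning

  pairSum-IsAG : IsAG pairSum
  pairSum-IsAG = a₀ , a₁ , a₂ , recurrence
    where
    s₁ : s 1 ≡ 0ℚ
    s₁ = sech-odd 1 refl
    s₃ : s 3 ≡ 0ℚ
    s₃ = sech-odd 3 refl
    a₀ : s 0 + s 1 ≡ 1ℚ
    a₀ = cong₂ _+_ s₀ s₁
    a₁ : s 1 + s 2 ≡ - 1ℚ
    a₁ = cong₂ _+_ s₁ s₂
    a₂ : s 2 + s 3 ≡ - 1ℚ
    a₂ = cong₂ _+_ s₂ s₃
    recurrence : ∀ m →
      pairSum (3 ℕ.+ m) ≡ - (½ · ( sumTo (1 ℕ.+ m) (λ k → pairSum k · ι ((2 ℕ.+ m) C k) · ι (2 ^ (2 ℕ.+ m ∸ k)))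
                                 + sumTo (2 ℕ.+ m) (λ k → pairSum k · ι ((3 ℕ.+ m) C k) · ι (2 ^ (3 ℕ.+ m ∸ k)))))
    recurrence m = sym (begin
      - (½ · (sumTo (1 ℕ.+ m) _ + sumTo (2 ℕ.+ m) _))
        ≡⟨ cong (λ x → - (½ · x)) (cong₂ _+_ (⋆exp2-init pairSum (1 ℕ.+ m)) (⋆exp2-init pairSum (2 ℕ.+ m))) ⟩
      - (½ · (((pairSum ⋆ exp2) (2 ℕ.+ m) - pairSum (2 ℕ.+ m)) + ((pairSum ⋆ exp2) (3 ℕ.+ m) - pairSum (3 ℕ.+ m))))
        ≡⟨ cong₂ (λ u v → - (½ · ((u - pairSum (2 ℕ.+ m)) + (v - pairSum (3 ℕ.+ m)))))
                 (pairSum⋆exp2 (2 ℕ.+ m)) (pairSum⋆exp2 (3 ℕ.+ m)) ⟩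
      - (½ · (((a - b) - (a + b)) + ((b - c) - (b + c))))
        ≡⟨ solve 3 (λ a b c → :- (con ½ :* (((a :- b) :- (a :+ b)) :+ ((b :- c) :- (b :+ c)))) := b :+ c)
                   refl a b c ⟩
      b + c ∎)
      where
      open ≡-Reasoning
      a b c : ℚ
      a = s (2 ℕ.+ m)
      b = s (3 ℕ.+ m)
      c = s (4 ℕ.+ m)

IsAG-unique : (a b : Seq) → IsAG a → IsAG b → ∀ n → a n ≡ b n
IsAG-unique a b (a₀ , a₁ , a₂ , aᵣ) (b₀ , b₁ , b₂ , bᵣ) = <-rec (λ n → a n ≡ b n) step
  where
  agree : ∀ p {w v : Seq} → (∀ {k} → k ≤ p → a k ≡ b k) →
          sumTo p (λ k → a k · w k · v k) ≡ sumTo p (λ k → b k · w k · v k)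
  agree p {w} {v} a≗b = sumTo-cong p (λ k k≤p → cong (λ x → x · w k · v k) (a≗b k≤p))
  step : ∀ n → (∀ {k} → k < n → a k ≡ b k) → a n ≡ b n
  step 0 _ = trans a₀ (sym b₀)
  step 1 _ = trans a₁ (sym b₁)
  step 2 _ = trans a₂ (sym b₂)
  step (suc (suc (suc m))) ih =
    trans (aᵣ m)
      (trans (cong (λ x → - (½ · x))
                   (cong₂ _+_ (agree (suc m) (λ k≤ → ih (s≤s (ℕ.m≤n⇒m≤1+n k≤))))
                              (agree (suc (suc m)) (λ k≤ → ih (s≤s k≤)))))
             (sym (bᵣ m)))

mainTheorem7 : (a s : ℕ → ℚ) → IsAG a → IsSechCoeffs s →
                 ∀ n → (s (suc (2 * n)) ≡ 0ℚ) × (s (2 * n) ≡ a (2 * n))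
mainTheorem7 a s isAG sech n = s[2n+1]≡0 , (begin
  s (2 * n)                      ≡⟨ sym (+-identityʳ (s (2 * n))) ⟩
  s (2 * n) + 0ℚ                 ≡⟨ cong (_+_ (s (2 * n))) (sym s[2n+1]≡0) ⟩
  pairSum (2 * n)                ≡⟨ IsAG-unique pairSum a pairSum-IsAG isAG (2 * n) ⟩
  a (2 * n)                      ∎)
  where
  open Sech sech
  open ≡-Reasoning
  s[2n+1]≡0 : s (suc (2 * n)) ≡ 0ℚ
  s[2n+1]≡0 = sech-odd (suc (2 * n)) (cong not (odd-double n))
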